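{- Let $r>0$, let $\mathbf{k}=(k_1,\ldots,k_{r-1};k_r)$ with all $k_i\in\mathbb{N}$, and let $\sigma\in\mathfrak{S}_r$. Then $$\pi\big((M^{(\mathbf{k})}-M^{(\sigma(\mathbf{k}))})x_1\big)\in\operatorname{Ker}\mathrm{Li}^-_\bullet,$$ where $\sigma(\mathbf{k}):=(k_{\sigma(1)},\ldots,k_{\sigma(r-1)};k_{\sigma(r)})$.
   Context: $\mathbb{N}$ is the set of non-negative integers. For $\mathbf{s}=(s_1,\ldots,s_m)\in\mathbb{N}^m$ put $\mathrm{Li}^-_{\mathbf{s}}(z):=\sum_{n_1>\cdots>n_m>0}n_1^{s_1}\cdots n_m^{s_m}z^{n_1}$ for $|z|<1$ (empty index gives $1$), a rational function in $\mathbb{C}[z,(1-z)^{ -1}]$. Let $\mathbb{C}\langle Y\rangle$ be the free associative $\mathbb{C}$-algebra on $Y=\{y_0,y_1,\ldots\}$ and $\mathrm{Li}^-_\bullet:\mathbb{C}\langle Y\rangle\to\mathbb{C}[z,(1-z)^{ -1}]$ the $\mathbb{C}$-linear map with $y_{s_1}\cdots y_{s_m}\mapsto\mathrm{Li}^-_{(s_1,\ldots,s_m)}$. Let $\pi:\mathbb{C}\langle x_0,x_1\rangle x_1\to\mathbb{C}\langle Y\rangle$ be the linear isomorphism from the span of words in $x_0,x_1$ ending in $x_1$, $x_0^{s_1}x_1\cdots x_0^{s_m}x_1\mapsto y_{s_1}\cdots y_{s_m}$. Define $x_1^{(0)}:=x_1$, $x_1^{(n)}:=x_0x_1^{(n-1)}-x_1^{(n-1)}x_0$,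 and the Magnus polynomial $M^{(k_1,\ldots,k_{r-1};k_r)}:=x_1^{(k_1)}\cdots x_1^{(k_{r-1})}x_0^{k_r}$. -}

module Defs where

open import Data.Nat as ℕ using (ℕ; zero; suc)
open import Data.Integer as ℤ using (ℤ; +_)
open import Data.List using (List; []; _∷_; _++_; map; concatMap; foldr)
open import Data.Product using (_×_; _,_)
open import Data.Fin using (Fin; zero; suc)
open import Data.Fin.Permutation using (Permutation′; _⟨$⟩ʳ_)
open import Relation.Binary.PropositionalEquality using (_≡_)

data X : Set where
  x₀ x₁ : X

Word : Set
Word = List X

-- Noncommutative polynomials in x0, x1 with integer coefficients,
-- represented as formal finite sums (lists of (coefficient, word)).
Poly : Set
Poly = List (ℤ × Word)

letter : X → Poly
letter a = (+ 1 , a ∷ []) ∷ []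

one : Poly
one = (+ 1 , []) ∷ []

_⊕_ : Poly → Poly → Poly
p ⊕ q = p ++ q

⊖_ : Poly → Poly
⊖ p = map (λ { (c , w) → (ℤ.- c , w) }) p

_⊗_ : Poly → Poly → Poly
p ⊗ q = concatMap (λ { (c , v) → map (λ { (d , w) → (c ℤ.* d , v ++ w) }) q }) p

infixl 6 _⊕_
infixl 7 _⊗_

x₀^ : ℕ → Poly
x₀^ zero = one
x₀^ (suc n) = letter x₀ ⊗ x₀^ n

x₁⁽_⁾ : ℕ → Poly
x₁⁽ zero ⁾ = letter x₁
x₁⁽ suc n ⁾ = letter x₀ ⊗ x₁⁽ n ⁾ ⊕ ⊖ (x₁⁽ n ⁾ ⊗ letter x₀)

-- Magnus polynomial M^(k_1,...,k_{r-1};k_r) with r = suc n,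
-- k : Fin (suc n) → ℕ, last entry k (fromℕ n) is k_r.
Magnus : (n : ℕ) → (Fin (suc n) → ℕ) → Poly
Magnus zero k = x₀^ (k zero)
Magnus (suc n) k = x₁⁽ k zero ⁾ ⊗ Magnus n (λ i → k (suc i))

permute : {r : ℕ} → Permutation′ r → (Fin r → ℕ) → (Fin r → ℕ)
permute σ k i = k (σ ⟨$⟩ʳ i)

-- π on a single word of the form w·x1 :
-- x0^{s1} x1 ... x0^{sm} x1  ↦  (s1,...,sm).
-- πx₁-aux c w : c = number of x0 read since the last x1.
πx₁-aux : ℕ → Word → List ℕ
πx₁-aux c [] = c ∷ []               -- the final (appended) x1 closes the last block
πx₁-aux c (x₀ ∷ w) = πx₁-aux (suc c) w
πx₁-aux c (x₁ ∷ w) = c ∷ πx₁-aux zero w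

πx₁ : Word → List ℕ
πx₁ w = πx₁-aux zero w

Σ< : ℕ → (ℕ → ℤ) → ℤ
Σ< zero f = + 0
Σ< (suc n) f = Σ< n f ℤ.+ f n

-- Coefficient of z^n in Li^-_{s}(z) = Σ_{n1>...>nm>0} n1^{s1}...nm^{sm} z^{n1}.
-- Empty index: Li^- = 1.
LiCoeff : List ℕ → ℕ → ℤ
LiCoeff [] zero = + 1
LiCoeff [] (suc n) = + 0
LiCoeff (s ∷ ss) n = (+ (n ℕ.^ s)) ℤ.* Σ< n (LiCoeff ss)

-- Li^-_•(π(p·x1)) as a power series (coefficient sequence) in z:
-- p·x1 = Σ c_w (w x1), π(p x1) = Σ c_w π(w x1), and Li^- is linear.
Li∘π·x₁ : Poly → ℕ → ℤ
Li∘π·x₁ p n = foldr (λ { (c , w) acc → c ℤ.* LiCoeff (πx₁ w) n ℤ.+ acc }) (+ 0) p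

InKerLi∘π·x₁ : Poly → Set
InKerLi∘π·x₁ p = ∀ n → Li∘π·x₁ p n ≡ + 0

{-# OPTIONS --safe #-}
module Submission where

-- Identify a power series with its coefficient sequence and let θ = z d/dz and
-- Λ = multiplication by z/(1 − z). Then Li⁻_(s₁,…,s_m) = θ^s₁ Λ ⋯ θ^s_m Λ 1, so Li⁻_•(π(p x₁))
-- is the operator ⟦p⟧ obtained from p by x₀ ↦ θ, x₁ ↦ Λ, applied to Λ 1. As θ is a derivation
-- with θ Li⁻_k = Li⁻_(k+1), the recursion x₁^(k+1) = [x₀, x₁^(k)] makes x₁^(k) act as
-- multiplication by Li⁻_k, while x₀^k Λ 1 = Li⁻_k. Hence Li⁻_•(π(M^(k) x₁)) = Li⁻_k₁ ⋯ Li⁻_k_r,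
-- which is symmetric in k. Instead of appealing to commutativity of the product of series, the
-- multiplication operators are shown to commute by induction on k, from [Λ, Li⁻_k ·] = 0 and
-- the commutator formula.

open import Defs
open import Data.Nat using (ℕ; suc)
open import Data.Fin using (Fin)
open import Data.Fin.Permutation using (Permutation′)

open import Data.Fin using (zero; suc; punchIn)
open import Data.Fin.Permutation using (_⟨$⟩ʳ_; remove; punchIn-permute)
open import Data.Integer using (ℤ; +_; _+_; _-_; _*_; -_)
import Data.Integer.Properties as ℤP
open import Data.Integer.Tactic.RingSolver using (solve-∀)
open import Data.List using ([]; _∷_; _++_; map)
open import Data.Nat as ℕ using (zero; _∸_; _^_; _<_)
import Data.Nat.Properties as ℕP
open import Data.Product using (_×_; _,_)
open import Data.Vec.Functional using (Vector; foldr; tail)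
open import Function using (_∘_)
open import Relation.Binary.Bundles using (Setoid)
open import Relation.Binary.PropositionalEquality
open import Algebra.Properties.CommutativeSemigroup ℤP.+-commutativeSemigroup using (interchange)

module _ {a ℓ b} (S : Setoid a ℓ) {I : Set b} {F : I → Setoid.Carrier S → Setoid.Carrier S}
         (F-cong : ∀ i {x y} → Setoid._≈_ S x y → Setoid._≈_ S (F i x) (F i y)) where
  open Setoid S using (_≈_) renaming (refl to ≈-refl)
  open import Relation.Binary.Reasoning.Setoid S

  foldr-cong : ∀ {n} {k k′ : Vector I n} → (∀ j → k j ≡ k′ j) → ∀ x → foldr F x k ≈ foldr F x k′
  foldr-cong {zero}  k≡k′ x = ≈-refl
  foldr-cong {suc n} {k} {k′} k≡k′ x = begin
    F (k zero) (foldr F x (tail k))   ≈⟨ F-cong (k zero) (foldr-cong (k≡k′ ∘ suc) x) ⟩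
    F (k zero) (foldr F x (tail k′))  ≡⟨ cong (λ i → F i (foldr F x (tail k′))) (k≡k′ zero) ⟩
    F (k′ zero) (foldr F x (tail k′)) ∎

  module _ (F-comm : ∀ i j x → F i (F j x) ≈ F j (F i x)) where

    foldr-punchIn : ∀ {n} (k : Vector I (suc n)) i x →
                    foldr F x k ≈ F (k i) (foldr F x (k ∘ punchIn i))
    foldr-punchIn         k zero    x = ≈-refl
    foldr-punchIn {suc n} k (suc i) x = begin
      F (k zero) (foldr F x (tail k))
        ≈⟨ F-cong (k zero) (foldr-punchIn (tail k) i x) ⟩
      F (k zero) (F (k (suc i)) (foldr F x (tail k ∘ punchIn i)))
        ≈⟨ F-comm (k zero) (k (suc i)) _ ⟩
      F (k (suc i)) (F (k zero) (foldr F x (tail k ∘ punchIn i))) ∎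

    foldr-permute : ∀ {n} (k : Vector I n) (σ : Permutation′ n) x →
                    foldr F x (k ∘ (σ ⟨$⟩ʳ_)) ≈ foldr F x k
    foldr-permute {zero}  k σ x = ≈-refl
    foldr-permute {suc n} k σ x = begin
      F (k i₀) (foldr F x (λ j → k (σ ⟨$⟩ʳ suc j)))
        ≈⟨ F-cong (k i₀) (foldr-cong (λ j → cong k (punchIn-permute σ zero j)) x) ⟩
      F (k i₀) (foldr F x (k ∘ punchIn i₀ ∘ (remove zero σ ⟨$⟩ʳ_)))
        ≈⟨ F-cong (k i₀) (foldr-permute (k ∘ punchIn i₀) (remove zero σ) x) ⟩
      F (k i₀) (foldr F x (k ∘ punchIn i₀))
        ≈⟨ foldr-punchIn k i₀ x ⟨
      foldr F x k ∎
      where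
      i₀ : Fin (suc n)
      i₀ = σ ⟨$⟩ʳ zero

open ≡-Reasoning

Σ<-cong : ∀ n {f g : ℕ → ℤ} → f ≗ g → Σ< n f ≡ Σ< n g
Σ<-cong zero    f≗g = refl
Σ<-cong (suc n) f≗g = cong₂ _+_ (Σ<-cong n f≗g) (f≗g n)

Σ<-cong-< : ∀ n {f g : ℕ → ℤ} → (∀ m → m < n → f m ≡ g m) → Σ< n f ≡ Σ< n g
Σ<-cong-< zero    f≡g = refl
Σ<-cong-< (suc n) f≡g =
  cong₂ _+_ (Σ<-cong-< n (λ m m<n → f≡g m (ℕP.m<n⇒m<1+n m<n))) (f≡g n (ℕP.n<1+n n))

Σ<-+ : ∀ n (f g : ℕ → ℤ) → Σ< n (λ m → f m + g m) ≡ Σ< n f + Σ< n g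
Σ<-+ zero    f g = refl
Σ<-+ (suc n) f g =
  trans (cong (_+ (f n + g n)) (Σ<-+ n f g)) (interchange (Σ< n f) (Σ< n g) (f n) (g n))

Σ<-neg : ∀ n (f : ℕ → ℤ) → Σ< n (λ m → - f m) ≡ - Σ< n f
Σ<-neg zero    f = refl
Σ<-neg (suc n) f = trans (cong (_+ - f n) (Σ<-neg n f)) (sym (ℤP.neg-distrib-+ (Σ< n f) (f n)))

Σ<-minus : ∀ n (f g : ℕ → ℤ) → Σ< n (λ m → f m - g m) ≡ Σ< n f - Σ< n g
Σ<-minus n f g = trans (Σ<-+ n f (-_ ∘ g)) (cong (λ x → Σ< n f + x) (Σ<-neg n g))

Σ<-*ˡ : ∀ n c (f : ℕ → ℤ) → Σ< n (λ m → c * f m) ≡ c * Σ< n f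
Σ<-*ˡ zero    c f = sym (ℤP.*-zeroʳ c)
Σ<-*ˡ (suc n) c f =
  trans (cong (_+ c * f n) (Σ<-*ˡ n c f)) (sym (ℤP.*-distribˡ-+ c (Σ< n f) (f n)))

Σ<-zero : ∀ n → Σ< n (λ _ → + 0) ≡ + 0
Σ<-zero zero    = refl
Σ<-zero (suc n) = cong (_+ + 0) (Σ<-zero n)

Σ<-suc-head : ∀ n (f : ℕ → ℤ) → Σ< (suc n) f ≡ f 0 + Σ< n (f ∘ suc)
Σ<-suc-head zero    f = trans (ℤP.+-identityˡ (f 0)) (sym (ℤP.+-identityʳ (f 0)))
Σ<-suc-head (suc n) f =
  trans (cong (_+ f (suc n)) (Σ<-suc-head n f)) (ℤP.+-assoc (f 0) (Σ< n (f ∘ suc)) (f (suc n)))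

Series : Set
Series = ℕ → ℤ

θ : Series → Series
θ h N = + N * h N

Λ : Series → Series
Λ h N = Σ< N h

mulLi⁻ : ℕ → Series → Series
mulLi⁻ k h N = Σ< N (λ m → + ((N ∸ m) ^ k) * h m)

δ₀ : Series
δ₀ = LiCoeff []

θ-cong : ∀ {h h′} → h ≗ h′ → θ h ≗ θ h′
θ-cong h≗h′ N = cong (+ N *_) (h≗h′ N)

Λ-cong : ∀ {h h′} → h ≗ h′ → Λ h ≗ Λ h′
Λ-cong h≗h′ N = Σ<-cong N h≗h′

mulLi⁻-cong : ∀ k {h h′} → h ≗ h′ → mulLi⁻ k h ≗ mulLi⁻ k h′
mulLi⁻-cong k h≗h′ N = Σ<-cong N (λ m → cong (+ ((N ∸ m) ^ k) *_) (h≗h′ m))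

mulLi⁻-+ : ∀ k (f g : Series) N → mulLi⁻ k (λ M → f M + g M) N ≡ mulLi⁻ k f N + mulLi⁻ k g N
mulLi⁻-+ k f g N =
  trans (Σ<-cong N (λ m → ℤP.*-distribˡ-+ (+ ((N ∸ m) ^ k)) (f m) (g m))) (Σ<-+ N _ _)

mulLi⁻-minus : ∀ k (f g : Series) N → mulLi⁻ k (λ M → f M - g M) N ≡ mulLi⁻ k f N - mulLi⁻ k g N
mulLi⁻-minus k f g N = trans (Σ<-cong N *-distribˡ-minus) (Σ<-minus N _ _)
  where
  *-distribˡ-minus : ∀ m → + ((N ∸ m) ^ k) * (f m - g m) ≡ + ((N ∸ m) ^ k) * f m - + ((N ∸ m) ^ k) * g m
  *-distribˡ-minus m = trans (ℤP.*-distribˡ-+ p (f m) (- g m))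
                         (cong (λ x → p * f m + x) (sym (ℤP.neg-distribʳ-* p (g m))))
    where p = + ((N ∸ m) ^ k)

mulLi⁻-zero : ∀ h → mulLi⁻ 0 h ≗ Λ h
mulLi⁻-zero h N = Σ<-cong N (λ m → ℤP.*-identityˡ (h m))

θ-mulLi⁻ : ∀ k h N → θ (mulLi⁻ k h) N ≡ mulLi⁻ (suc k) h N + mulLi⁻ k (θ h) N
θ-mulLi⁻ k h N = begin
    + N * Σ< N (λ m → P m * h m)
  ≡⟨ Σ<-*ˡ N (+ N) _ ⟨
    Σ< N (λ m → + N * (P m * h m))
  ≡⟨ Σ<-cong-< N split ⟩
    Σ< N (λ m → + ((N ∸ m) ^ suc k) * h m + P m * (+ m * h m))
  ≡⟨ Σ<-+ N _ _ ⟩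
    mulLi⁻ (suc k) h N + mulLi⁻ k (θ h) N
  ∎
  where
  P : ℕ → ℤ
  P m = + ((N ∸ m) ^ k)
  distribute : ∀ a b p x → (a + b) * (p * x) ≡ a * p * x + p * (b * x)
  distribute = solve-∀
  -- N ≡ (N ∸ m) + m needs m ≤ N, as ∸ truncates.
  split : ∀ m → m < N → + N * (P m * h m) ≡ + ((N ∸ m) ^ suc k) * h m + P m * (+ m * h m)
  split m m<N = begin
      + N * (P m * h m)
    ≡⟨ cong (λ n → + n * (P m * h m)) (ℕP.m∸n+n≡m (ℕP.<⇒≤ m<N)) ⟨
      + (N ∸ m ℕ.+ m) * (P m * h m)
    ≡⟨ distribute (+ (N ∸ m)) (+ m) (P m) (h m) ⟩
      + (N ∸ m) * P m * h m + P m * (+ m * h m)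
    ≡⟨ cong (λ a → a * h m + P m * (+ m * h m)) (ℤP.pos-* (N ∸ m) ((N ∸ m) ^ k)) ⟨
      + ((N ∸ m) ^ suc k) * h m + P m * (+ m * h m)
    ∎

mulLi⁻-suc : ∀ k h N → mulLi⁻ (suc k) h N ≡ θ (mulLi⁻ k h) N - mulLi⁻ k (θ h) N
mulLi⁻-suc k h N = begin
    mulLi⁻ (suc k) h N
  ≡⟨ x+y-y≡x (mulLi⁻ (suc k) h N) (mulLi⁻ k (θ h) N) ⟨
    mulLi⁻ (suc k) h N + mulLi⁻ k (θ h) N - mulLi⁻ k (θ h) N
  ≡⟨ cong (_- mulLi⁻ k (θ h) N) (θ-mulLi⁻ k h N) ⟨
    θ (mulLi⁻ k h) N - mulLi⁻ k (θ h) N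
  ∎
  where
  x+y-y≡x : ∀ x y → x + y - y ≡ x
  x+y-y≡x = solve-∀

Λ-mulLi⁻ : ∀ k h → Λ (mulLi⁻ k h) ≗ mulLi⁻ k (Λ h)
Λ-mulLi⁻ k h zero    = refl
Λ-mulLi⁻ k h (suc N) = begin
    Λ (mulLi⁻ k h) N + mulLi⁻ k h N
  ≡⟨ cong (_+ mulLi⁻ k h N) (Λ-mulLi⁻ k h N) ⟩
    mulLi⁻ k (Λ h) N + mulLi⁻ k h N
  ≡⟨ mulLi⁻-+ k (Λ h) h N ⟨
    tail-sum
  ≡⟨ ℤP.+-identityˡ tail-sum ⟨
    + 0 + tail-sum
  ≡⟨ cong (_+ tail-sum) (ℤP.*-zeroʳ (+ (suc N ^ k))) ⟨
    + (suc N ^ k) * Λ h 0 + tail-sum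
  ≡⟨ Σ<-suc-head N _ ⟨
    mulLi⁻ k (Λ h) (suc N)
  ∎
  where
  tail-sum : ℤ
  tail-sum = Σ< N (λ m → + ((N ∸ m) ^ k) * Λ h (suc m))

mulLi⁻-comm : ∀ a b g → mulLi⁻ a (mulLi⁻ b g) ≗ mulLi⁻ b (mulLi⁻ a g)
mulLi⁻-comm zero b g N = begin
    mulLi⁻ 0 (mulLi⁻ b g) N  ≡⟨ mulLi⁻-zero (mulLi⁻ b g) N ⟩
    Λ (mulLi⁻ b g) N         ≡⟨ Λ-mulLi⁻ b g N ⟩
    mulLi⁻ b (Λ g) N         ≡⟨ mulLi⁻-cong b (mulLi⁻-zero g) N ⟨
    mulLi⁻ b (mulLi⁻ 0 g) N  ∎
mulLi⁻-comm (suc a) b g N = begin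
    mulLi⁻ (suc a) (mulLi⁻ b g) N
  ≡⟨ mulLi⁻-suc a (mulLi⁻ b g) N ⟩
    θ (mulLi⁻ a (mulLi⁻ b g)) N - mulLi⁻ a (θ (mulLi⁻ b g)) N
  ≡⟨ cong₂ _-_ (θ-cong (mulLi⁻-comm a b g) N) expand ⟩
    θ (mulLi⁻ b (mulLi⁻ a g)) N - (mulLi⁻ (suc b) (mulLi⁻ a g) N + mulLi⁻ b (mulLi⁻ a (θ g)) N)
  ≡⟨ x-[y+z]≡x-y-z (θ (mulLi⁻ b (mulLi⁻ a g)) N) _ _ ⟩
    θ (mulLi⁻ b (mulLi⁻ a g)) N - mulLi⁻ (suc b) (mulLi⁻ a g) N - mulLi⁻ b (mulLi⁻ a (θ g)) N
  ≡⟨ cong (_- mulLi⁻ b (mulLi⁻ a (θ g)) N) (x≡y+z⇒x-y≡z (θ-mulLi⁻ b (mulLi⁻ a g) N)) ⟩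
    mulLi⁻ b (θ (mulLi⁻ a g)) N - mulLi⁻ b (mulLi⁻ a (θ g)) N
  ≡⟨ mulLi⁻-minus b (θ (mulLi⁻ a g)) (mulLi⁻ a (θ g)) N ⟨
    mulLi⁻ b (λ M → θ (mulLi⁻ a g) M - mulLi⁻ a (θ g) M) N
  ≡⟨ mulLi⁻-cong b (mulLi⁻-suc a g) N ⟨
    mulLi⁻ b (mulLi⁻ (suc a) g) N
  ∎
  where
  x-[y+z]≡x-y-z : ∀ x y z → x - (y + z) ≡ x - y - z
  x-[y+z]≡x-y-z = solve-∀
  x≡y+z⇒x-y≡z : ∀ {x y z} → x ≡ y + z → x - y ≡ z
  x≡y+z⇒x-y≡z {y = y} {z} refl = lemma y z
    where
    lemma : ∀ y z → y + z - y ≡ z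
    lemma = solve-∀
  expand : mulLi⁻ a (θ (mulLi⁻ b g)) N ≡ mulLi⁻ (suc b) (mulLi⁻ a g) N + mulLi⁻ b (mulLi⁻ a (θ g)) N
  expand = begin
      mulLi⁻ a (θ (mulLi⁻ b g)) N
    ≡⟨ mulLi⁻-cong a (θ-mulLi⁻ b g) N ⟩
      mulLi⁻ a (λ M → mulLi⁻ (suc b) g M + mulLi⁻ b (θ g) M) N
    ≡⟨ mulLi⁻-+ a (mulLi⁻ (suc b) g) (mulLi⁻ b (θ g)) N ⟩
      mulLi⁻ a (mulLi⁻ (suc b) g) N + mulLi⁻ a (mulLi⁻ b (θ g)) N
    ≡⟨ cong₂ _+_ (mulLi⁻-comm a (suc b) g N) (mulLi⁻-comm a b (θ g) N) ⟩
      mulLi⁻ (suc b) (mulLi⁻ a g) N + mulLi⁻ b (mulLi⁻ a (θ g)) N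
    ∎

Σ<-*δ₀ : ∀ n (f : ℕ → ℤ) → Σ< (suc n) (λ m → f m * δ₀ m) ≡ f 0
Σ<-*δ₀ zero    f = trans (ℤP.+-identityˡ (f 0 * + 1)) (ℤP.*-identityʳ (f 0))
Σ<-*δ₀ (suc n) f =
  trans (cong₂ _+_ (Σ<-*δ₀ n f) (ℤP.*-zeroʳ (f (suc n)))) (ℤP.+-identityʳ (f 0))

Λδ₀-suc : ∀ N → Λ δ₀ (suc N) ≡ + 1
Λδ₀-suc zero    = refl
Λδ₀-suc (suc N) = cong (_+ + 0) (Λδ₀-suc N)

mulLi⁻-δ₀ : ∀ k N → mulLi⁻ k δ₀ N ≡ + (N ^ k) * Λ δ₀ N
mulLi⁻-δ₀ k zero    = sym (ℤP.*-zeroʳ (+ (0 ^ k)))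
mulLi⁻-δ₀ k (suc N) = begin
    Σ< (suc N) (λ m → + ((suc N ∸ m) ^ k) * δ₀ m)  ≡⟨ Σ<-*δ₀ N (λ m → + ((suc N ∸ m) ^ k)) ⟩
    + (suc N ^ k)                                  ≡⟨ ℤP.*-identityʳ (+ (suc N ^ k)) ⟨
    + (suc N ^ k) * + 1                            ≡⟨ cong (+ (suc N ^ k) *_) (Λδ₀-suc N) ⟨
    + (suc N ^ k) * Λ δ₀ (suc N)                   ∎

linExt : (Word → ℤ) → Poly → ℤ
linExt f []            = + 0
linExt f ((c , w) ∷ p) = c * f w + linExt f p

linExt-cong : ∀ {f g : Word → ℤ} → f ≗ g → ∀ p → linExt f p ≡ linExt g p
linExt-cong f≗g []            = refl
linExt-cong f≗g ((c , w) ∷ p) = cong₂ (λ x y → c * x + y) (f≗g w) (linExt-cong f≗g p)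

linExt-++ : ∀ f p q → linExt f (p ++ q) ≡ linExt f p + linExt f q
linExt-++ f []            q = sym (ℤP.+-identityˡ (linExt f q))
linExt-++ f ((c , w) ∷ p) q =
  trans (cong (λ x → c * f w + x) (linExt-++ f p q))
        (sym (ℤP.+-assoc (c * f w) (linExt f p) (linExt f q)))

linExt-⊖ : ∀ f p → linExt f (⊖ p) ≡ - linExt f p
linExt-⊖ f []            = refl
linExt-⊖ f ((c , w) ∷ p) =
  trans (cong₂ _+_ (sym (ℤP.neg-distribˡ-* c (f w))) (linExt-⊖ f p))
        (sym (ℤP.neg-distrib-+ (c * f w) (linExt f p)))

linExt-*ˡ : ∀ a f p → linExt (λ w → a * f w) p ≡ a * linExt f p
linExt-*ˡ a f []            = sym (ℤP.*-zeroʳ a)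
linExt-*ˡ a f ((c , w) ∷ p) =
  trans (cong (λ x → c * (a * f w) + x) (linExt-*ˡ a f p)) (regroup c a (f w) (linExt f p))
  where
  regroup : ∀ c a x y → c * (a * x) + a * y ≡ a * (c * x + y)
  regroup = solve-∀

linExt-Σ< : ∀ n (F : Word → ℕ → ℤ) p →
            linExt (λ w → Σ< n (F w)) p ≡ Σ< n (λ m → linExt (λ w → F w m) p)
linExt-Σ< n F []            = sym (Σ<-zero n)
linExt-Σ< n F ((c , w) ∷ p) = begin
    c * Σ< n (F w) + linExt (λ v → Σ< n (F v)) p
  ≡⟨ cong₂ _+_ (sym (Σ<-*ˡ n c (F w))) (linExt-Σ< n F p) ⟩
    Σ< n (λ m → c * F w m) + Σ< n (λ m → linExt (λ v → F v m) p)
  ≡⟨ Σ<-+ n _ _ ⟨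
    Σ< n (λ m → c * F w m + linExt (λ v → F v m) p)
  ∎

-- H abstracts the pattern-matching lambda inside the definition of _⊗_.
linExt-map-prefix : ∀ (H : ℤ × Word → ℤ × Word) c v → (∀ d w → H (d , w) ≡ (c * d , v ++ w)) →
                    ∀ f q → linExt f (map H q) ≡ c * linExt (f ∘ (v ++_)) q
linExt-map-prefix H c v H≡ f []            = sym (ℤP.*-zeroʳ c)
linExt-map-prefix H c v H≡ f ((d , w) ∷ q) rewrite H≡ d w = begin
    c * d * f (v ++ w) + linExt f (map H q)
  ≡⟨ cong₂ _+_ (ℤP.*-assoc c d (f (v ++ w))) (linExt-map-prefix H c v H≡ f q) ⟩
    c * (d * f (v ++ w)) + c * linExt (f ∘ (v ++_)) q
  ≡⟨ ℤP.*-distribˡ-+ c _ _ ⟨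
    c * (d * f (v ++ w) + linExt (f ∘ (v ++_)) q)
  ∎

linExt-⊗ : ∀ f p q → linExt f (p ⊗ q) ≡ linExt (λ v → linExt (λ w → f (v ++ w)) q) p
linExt-⊗ f []            q = refl
linExt-⊗ f ((c , v) ∷ p) q =
  trans (linExt-++ f (map _ q) (p ⊗ q))
        (cong₂ _+_ (linExt-map-prefix _ c v (λ d w → refl) f q) (linExt-⊗ f p q))

act : Word → Series → Series
act []       h = h
act (x₀ ∷ w) h = θ (act w h)
act (x₁ ∷ w) h = Λ (act w h)

act-cong : ∀ w {h h′} → h ≗ h′ → act w h ≗ act w h′
act-cong []       h≗h′ = h≗h′
act-cong (x₀ ∷ w) h≗h′ = θ-cong (act-cong w h≗h′)
act-cong (x₁ ∷ w) h≗h′ = Λ-cong (act-cong w h≗h′)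

act-++ : ∀ v w h → act (v ++ w) h ≗ act v (act w h)
act-++ []       w h N = refl
act-++ (x₀ ∷ v) w h   = θ-cong (act-++ v w h)
act-++ (x₁ ∷ v) w h   = Λ-cong (act-++ v w h)

act-linExt : ∀ v (S : Word → Series) p N →
             linExt (λ w → act v (S w) N) p ≡ act v (λ M → linExt (λ w → S w M) p) N
act-linExt []       S p N = refl
act-linExt (x₀ ∷ v) S p N =
  trans (linExt-*ˡ (+ N) (λ w → act v (S w) N) p) (cong (+ N *_) (act-linExt v S p N))
act-linExt (x₁ ∷ v) S p N =
  trans (linExt-Σ< N (λ w → act v (S w)) p) (Σ<-cong N (act-linExt v S p))

⟦_⟧ : Poly → Series → Series
⟦ p ⟧ h N = linExt (λ w → act w h N) p

⟦⟧-cong : ∀ p {h h′} → h ≗ h′ → ⟦ p ⟧ h ≗ ⟦ p ⟧ h′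
⟦⟧-cong p h≗h′ N = linExt-cong (λ w → act-cong w h≗h′ N) p

⟦⟧-⊕ : ∀ p q h N → ⟦ p ⊕ q ⟧ h N ≡ ⟦ p ⟧ h N + ⟦ q ⟧ h N
⟦⟧-⊕ p q h N = linExt-++ _ p q

⟦⟧-⊖ : ∀ p h N → ⟦ ⊖ p ⟧ h N ≡ - ⟦ p ⟧ h N
⟦⟧-⊖ p h N = linExt-⊖ _ p

⟦⟧-⊗ : ∀ p q h → ⟦ p ⊗ q ⟧ h ≗ ⟦ p ⟧ (⟦ q ⟧ h)
⟦⟧-⊗ p q h N = trans (linExt-⊗ _ p q) (linExt-cong act-prefix p)
  where
  act-prefix : ∀ v → linExt (λ w → act (v ++ w) h N) q ≡ act v (⟦ q ⟧ h) N
  act-prefix v = trans (linExt-cong (λ w → act-++ v w h N) q) (act-linExt v (λ w → act w h) q N)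

⟦letter⟧ : ∀ a h → ⟦ letter a ⟧ h ≗ act (a ∷ []) h
⟦letter⟧ a h N = trans (ℤP.+-identityʳ _) (ℤP.*-identityˡ (act (a ∷ []) h N))

⟦x₀^⟧ : ∀ k h N → ⟦ x₀^ k ⟧ h N ≡ + (N ^ k) * h N
⟦x₀^⟧ zero    h N = ℤP.+-identityʳ (+ 1 * h N)
⟦x₀^⟧ (suc k) h N = begin
    ⟦ letter x₀ ⊗ x₀^ k ⟧ h N
  ≡⟨ trans (⟦⟧-⊗ (letter x₀) (x₀^ k) h N) (⟦letter⟧ x₀ (⟦ x₀^ k ⟧ h) N) ⟩
    + N * ⟦ x₀^ k ⟧ h N
  ≡⟨ cong (+ N *_) (⟦x₀^⟧ k h N) ⟩
    + N * (+ (N ^ k) * h N)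
  ≡⟨ ℤP.*-assoc (+ N) (+ (N ^ k)) (h N) ⟨
    + N * + (N ^ k) * h N
  ≡⟨ cong (_* h N) (ℤP.pos-* N (N ^ k)) ⟨
    + (N ^ suc k) * h N
  ∎

⟦x₁⁽⁾⟧ : ∀ k h → ⟦ x₁⁽ k ⁾ ⟧ h ≗ mulLi⁻ k h
⟦x₁⁽⁾⟧ zero    h N = trans (⟦letter⟧ x₁ h N) (sym (mulLi⁻-zero h N))
⟦x₁⁽⁾⟧ (suc k) h N = begin
    ⟦ letter x₀ ⊗ x₁⁽ k ⁾ ⊕ ⊖ (x₁⁽ k ⁾ ⊗ letter x₀) ⟧ h N
  ≡⟨ ⟦⟧-⊕ (letter x₀ ⊗ x₁⁽ k ⁾) _ h N ⟩
    ⟦ letter x₀ ⊗ x₁⁽ k ⁾ ⟧ h N + ⟦ ⊖ (x₁⁽ k ⁾ ⊗ letter x₀) ⟧ h N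
  ≡⟨ cong₂ _+_ (⟦⟧-⊗ (letter x₀) (x₁⁽ k ⁾) h N) (⟦⟧-⊖ (x₁⁽ k ⁾ ⊗ letter x₀) h N) ⟩
    ⟦ letter x₀ ⟧ (⟦ x₁⁽ k ⁾ ⟧ h) N - ⟦ x₁⁽ k ⁾ ⊗ letter x₀ ⟧ h N
  ≡⟨ cong₂ _-_ x₀x₁⁽k⁾ x₁⁽k⁾x₀ ⟩
    θ (mulLi⁻ k h) N - mulLi⁻ k (θ h) N
  ≡⟨ mulLi⁻-suc k h N ⟨
    mulLi⁻ (suc k) h N
  ∎
  where
  x₀x₁⁽k⁾ : ⟦ letter x₀ ⟧ (⟦ x₁⁽ k ⁾ ⟧ h) N ≡ θ (mulLi⁻ k h) N
  x₀x₁⁽k⁾ = trans (⟦letter⟧ x₀ (⟦ x₁⁽ k ⁾ ⟧ h) N) (θ-cong (⟦x₁⁽⁾⟧ k h) N)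
  x₁⁽k⁾x₀ : ⟦ x₁⁽ k ⁾ ⊗ letter x₀ ⟧ h N ≡ mulLi⁻ k (θ h) N
  x₁⁽k⁾x₀ = begin
    ⟦ x₁⁽ k ⁾ ⊗ letter x₀ ⟧ h N        ≡⟨ ⟦⟧-⊗ (x₁⁽ k ⁾) (letter x₀) h N ⟩
    ⟦ x₁⁽ k ⁾ ⟧ (⟦ letter x₀ ⟧ h) N   ≡⟨ ⟦⟧-cong (x₁⁽ k ⁾) (⟦letter⟧ x₀ h) N ⟩
    ⟦ x₁⁽ k ⁾ ⟧ (θ h) N                ≡⟨ ⟦x₁⁽⁾⟧ k (θ h) N ⟩
    mulLi⁻ k (θ h) N                   ∎

LiCoeff-πx₁ : ∀ w N → LiCoeff (πx₁ w) N ≡ act w (Λ δ₀) N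
LiCoeff-πx₁-aux : ∀ c w N → LiCoeff (πx₁-aux c w) N ≡ + (N ^ c) * act w (Λ δ₀) N

LiCoeff-πx₁ w N = trans (LiCoeff-πx₁-aux 0 w N) (ℤP.*-identityˡ (act w (Λ δ₀) N))

LiCoeff-πx₁-aux c []       N = refl
LiCoeff-πx₁-aux c (x₀ ∷ w) N = begin
    LiCoeff (πx₁-aux (suc c) w) N    ≡⟨ LiCoeff-πx₁-aux (suc c) w N ⟩
    + (N ℕ.* N ^ c) * act w (Λ δ₀) N  ≡⟨ cong (_* act w (Λ δ₀) N) (ℤP.pos-* N (N ^ c)) ⟩
    + N * + (N ^ c) * act w (Λ δ₀) N  ≡⟨ regroup (+ N) (+ (N ^ c)) (act w (Λ δ₀) N) ⟩
    + (N ^ c) * (+ N * act w (Λ δ₀) N) ∎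
  where
  regroup : ∀ a b x → a * b * x ≡ b * (a * x)
  regroup = solve-∀
LiCoeff-πx₁-aux c (x₁ ∷ w) N = cong (+ (N ^ c) *_) (Σ<-cong N (LiCoeff-πx₁ w))

Li∘π·x₁≗⟦⟧ : ∀ p → Li∘π·x₁ p ≗ ⟦ p ⟧ (Λ δ₀)
Li∘π·x₁≗⟦⟧ []            N = refl
Li∘π·x₁≗⟦⟧ ((c , w) ∷ p) N = cong₂ (λ x y → c * x + y) (LiCoeff-πx₁ w N) (Li∘π·x₁≗⟦⟧ p N)

⟦Magnus⟧ : ∀ n k → ⟦ Magnus n k ⟧ (Λ δ₀) ≗ foldr mulLi⁻ δ₀ k
⟦Magnus⟧ zero    k N = trans (⟦x₀^⟧ (k zero) (Λ δ₀) N) (sym (mulLi⁻-δ₀ (k zero) N))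
⟦Magnus⟧ (suc n) k N = begin
    ⟦ x₁⁽ k zero ⁾ ⊗ Magnus n (tail k) ⟧ (Λ δ₀) N
  ≡⟨ ⟦⟧-⊗ (x₁⁽ k zero ⁾) (Magnus n (tail k)) (Λ δ₀) N ⟩
    ⟦ x₁⁽ k zero ⁾ ⟧ (⟦ Magnus n (tail k) ⟧ (Λ δ₀)) N
  ≡⟨ ⟦x₁⁽⁾⟧ (k zero) (⟦ Magnus n (tail k) ⟧ (Λ δ₀)) N ⟩
    mulLi⁻ (k zero) (⟦ Magnus n (tail k) ⟧ (Λ δ₀)) N
  ≡⟨ mulLi⁻-cong (k zero) (⟦Magnus⟧ n (tail k)) N ⟩
    mulLi⁻ (k zero) (foldr mulLi⁻ δ₀ (tail k)) N
  ∎

theorem6p1 : (n : ℕ) (k : Fin (suc n) → ℕ) (σ : Permutation′ (suc n)) →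
    InKerLi∘π·x₁ (Magnus n k ⊕ ⊖ Magnus n (permute σ k))
theorem6p1 n k σ N = begin
    Li∘π·x₁ (M ⊕ ⊖ M′) N                ≡⟨ Li∘π·x₁≗⟦⟧ (M ⊕ ⊖ M′) N ⟩
    ⟦ M ⊕ ⊖ M′ ⟧ (Λ δ₀) N               ≡⟨ ⟦⟧-⊕ M (⊖ M′) (Λ δ₀) N ⟩
    ⟦ M ⟧ (Λ δ₀) N + ⟦ ⊖ M′ ⟧ (Λ δ₀) N  ≡⟨ cong (λ x → ⟦ M ⟧ (Λ δ₀) N + x) (⟦⟧-⊖ M′ (Λ δ₀) N) ⟩
    ⟦ M ⟧ (Λ δ₀) N - ⟦ M′ ⟧ (Λ δ₀) N    ≡⟨ cong₂ _-_ (⟦Magnus⟧ n k N) (⟦Magnus⟧ n (permute σ k) N) ⟩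
    L k N - L (permute σ k) N           ≡⟨ cong (λ x → L k N - x) (L-permute N) ⟩
    L k N - L k N                       ≡⟨ ℤP.+-inverseʳ (L k N) ⟩
    + 0                                 ∎
  where
  M M′ : Poly
  M  = Magnus n k
  M′ = Magnus n (permute σ k)
  L : (Fin (suc n) → ℕ) → Series
  L = foldr mulLi⁻ δ₀
  L-permute : L (permute σ k) ≗ L k
  L-permute = foldr-permute (ℕ →-setoid ℤ) mulLi⁻-cong mulLi⁻-comm k σ δ₀
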